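{- Let $\delta\ge0$ be an integer and let $G_1,\ldots,G_m$ be finite connected graphs each of degeneracy at most $\delta$. If $G$ is a subgraph (with at least one vertex) of $G_1\square\cdots\square G_m$, then $\frac{|E(G)|}{|V(G)|}\le 2\delta\cdot\log|V(G)|$.
   Context: All graphs finite, simple, undirected; $\log$ is base 2. The Cartesian product has vertex set $V(G_1)\times\cdots\times V(G_m)$, two tuples adjacent iff they differ in exactly one coordinate $j$ where they are adjacent in $G_j$. The degeneracy of a graph $F$ is the smallest $k$ such that the vertices of $F$ admit an order $v_1,\ldots,v_n$ in which each $v_i$ has degree at most $k$ in the subgraph induced by $v_i,\ldots,v_n$. -}

module Defs where

open import Data.Nat using (ℕ; zero; suc; _+_; _<ᵇ_)
open import Data.Bool using (Bool; true; false; _∧_; if_then_else_)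
open import Data.Fin using (Fin; toℕ; zero; suc)
open import Data.Fin.Permutation using (Permutation′; _⟨$⟩ʳ_)
open import Data.Product using (Σ; ∃; _×_; _,_)
open import Relation.Binary.PropositionalEquality using (_≡_; _≢_)
open import Relation.Binary.Construct.Closure.ReflexiveTransitive using (Star)
open import Data.Nat using (_≤_)

record Graph : Set where
  field
    n      : ℕ
    adj    : Fin n → Fin n → Bool
    sym    : ∀ i j → adj i j ≡ adj j i
    irrefl : ∀ i → adj i i ≡ false
open Graph public

countᵇ : ∀ {n} → (Fin n → Bool) → ℕ
countᵇ {zero}  f = 0
countᵇ {suc n} f = (if f zero then 1 else 0) + countᵇ (λ k → f (suc k))

∣V∣ : Graph → ℕ
∣V∣ G = n G

sumF : ∀ {n} → (Fin n → ℕ) → ℕ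
sumF {zero}  f = 0
sumF {suc n} f = f zero + sumF (λ i → f (suc i))

∣E∣ : Graph → ℕ
∣E∣ G = sumF (λ i → countᵇ (λ j → (toℕ i <ᵇ toℕ j) ∧ adj G i j))

Adj : (G : Graph) → Fin (n G) → Fin (n G) → Set
Adj G i j = adj G i j ≡ true

Connected : Graph → Set
Connected G = ∀ u v → Star (Adj G) u v

-- Degeneracy at most δ: there is an ordering v_0,...,v_{n-1} of the vertices
-- (a permutation σ, v_i = σ i) such that every v_i has at most δ neighbours
-- among v_{i+1},...,v_{n-1}, i.e. degree ≤ δ in the subgraph induced by v_i,...,v_{n-1}.
DegeneracyAtMost : ℕ → Graph → Set
DegeneracyAtMost δ G =
  Σ (Permutation′ (n G)) λ σ →
    ∀ i → countᵇ (λ j → (toℕ i <ᵇ toℕ j) ∧ adj G (σ ⟨$⟩ʳ i) (σ ⟨$⟩ʳ j)) ≤ δ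

ProdVertex : ∀ {m} → (Fin m → Graph) → Set
ProdVertex {m} Gs = (i : Fin m) → Fin (n (Gs i))

ProdAdj : ∀ {m} (Gs : Fin m → Graph) → ProdVertex Gs → ProdVertex Gs → Set
ProdAdj {m} Gs x y =
  ∃ λ (j : Fin m) → Adj (Gs j) (x j) (y j) × (∀ i → i ≢ j → x i ≡ y i)

_≈ᵥ_ : ∀ {m} {Gs : Fin m → Graph} → ProdVertex Gs → ProdVertex Gs → Set
_≈ᵥ_ {m} x y = ∀ (i : Fin m) → x i ≡ y i

SubgraphOfProduct : ∀ {m} → Graph → (Fin m → Graph) → Set
SubgraphOfProduct H Gs =
  Σ (Fin (n H) → ProdVertex Gs) λ φ →
    (∀ a b → _≈ᵥ_ {Gs = Gs} (φ a) (φ b) → a ≡ b) ×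
    (∀ a b → Adj H a b → ProdAdj Gs (φ a) (φ b))

module Submission where

-- Let f(s) = s ^ (2 δ s).  For a subgraph H of G₁ □ ⋯ □ G_m with δ-degenerate
-- factors we show 2 ^ e(S) ≤ f(|S|) for every vertex set S of H, by induction
-- on |S|; S = V(H) gives the theorem (|E| ≤ 2 δ |V| log |V|).
--
-- For a general graph, an
-- abstract recursion shows: if every S with two distinct vertices splits into
-- nonempty parts A, R with at most min(δ |A|, |R|) edges between them, then
-- the bound holds for all S.  For products such a split exists: choose a
-- coordinate j on which S is not constant and let A be the vertices of S whose
-- j-coordinate c comes first in the degeneracy order of G_j.  A vertex of R has
-- at most one neighbour in A, and a vertex of A has at most δ neighbours in R,
-- since their j-coordinates are distinct later neighbours of c.

open import Defs renaming (sym to adj-sym)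
open import Data.Nat using (ℕ; zero; suc; _+_; _*_; _^_; _≤_; _≥_; _<_; _<ᵇ_; _⊓_; z≤n; s≤s)
open import Data.Nat.Properties hiding (_≟_; suc-injective)
open import Data.Nat.Solver using (module +-*-Solver)
open import Data.Fin using (Fin; toℕ; zero; suc)
open import Data.Fin.Properties using (_≟_; any?; ¬∀⟶∃¬; toℕ-injective; suc-injective)
open import Data.Fin.Permutation using (_⟨$⟩ʳ_; _⟨$⟩ˡ_; inverseʳ)
open import Data.Bool using (Bool; true; false; _∧_; not; if_then_else_)
open import Data.Bool.Properties using (T-≡; ∧-zeroʳ) renaming (_≟_ to _≟ᵇ_)
open import Data.List using (filter; allFin)
open import Data.List.Extrema.Nat using (argmin; f[argmin]≤f[xs]; argmin-all)
open import Data.List.Membership.Propositional.Properties using (∈-filter⁺; ∈-allFin)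
open import Data.List.Relation.Unary.All using (lookup)
open import Data.List.Relation.Unary.All.Properties using (all-filter)
open import Data.Product using (Σ; ∃; _×_; _,_; proj₁; proj₂)
open import Data.Sum using (_⊎_; inj₁; inj₂)
open import Function using (_∘_; Equivalence)
open import Relation.Nullary using (Dec; yes; no; does; contradiction)
open import Relation.Nullary.Decidable using (_×-dec_; ¬?; dec-true; dec-false; decidable-stable)
open import Relation.Binary.PropositionalEquality hiding ([_])
open import Algebra.Properties.Semiring.Sum +-*-semiring
  using (sum; sum-syntax; ∑-distrib-+; ∑-comm; sum-cong-≗; sum-replicate-zero; *-distribʳ-sum)
import Algebra.Properties.CommutativeSemigroup +-commutativeSemigroup as +-Comm
import Algebra.Properties.CommutativeSemigroup *-commutativeSemigroup as *-Comm

[_] : Bool → ℕ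
[ b ] = if b then 1 else 0

Subset : ℕ → Set
Subset N = Fin N → Bool

∣_∣ : ∀ {N} → Subset N → ℕ
∣_∣ {N} P = ∑[ x < N ] [ P x ]

_∩_ _∖_ : ∀ {N} → Subset N → Subset N → Subset N
(P ∩ Q) x = P x ∧ Q x
(P ∖ Q) x = P x ∧ not (Q x)

_─_ : ∀ {N} → Subset N → Fin N → Subset N
(P ─ k) x = not (does (x ≟ k)) ∧ P x

AtMostOne : ∀ {N} → Subset N → Set
AtMostOne P = ∀ x y → P x ≡ true → P y ≡ true → x ≡ y

HasTwo : ∀ {N} → Subset N → Set
HasTwo P = ∃ λ x → ∃ λ y → P x ≡ true × P y ≡ true × x ≢ y

sumF≡sum : ∀ {N} (f : Fin N → ℕ) → sumF f ≡ sum f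
sumF≡sum {zero}  f = refl
sumF≡sum {suc N} f = cong (f zero +_) (sumF≡sum (f ∘ suc))

countᵇ≡∣∣ : ∀ {N} (P : Subset N) → countᵇ P ≡ ∣ P ∣
countᵇ≡∣∣ {zero}  P = refl
countᵇ≡∣∣ {suc N} P = cong ([ P zero ] +_) (countᵇ≡∣∣ (P ∘ suc))

sum-mono-≤ : ∀ {N} {f g : Fin N → ℕ} → (∀ i → f i ≤ g i) → sum f ≤ sum g
sum-mono-≤ {zero}  f≤g = z≤n
sum-mono-≤ {suc N} f≤g = +-mono-≤ (f≤g zero) (sum-mono-≤ (f≤g ∘ suc))

sum-zero : ∀ {N} {f : Fin N → ℕ} → (∀ i → f i ≡ 0) → sum f ≡ 0
sum-zero {N} f≡0 = trans (sum-cong-≗ f≡0) (sum-replicate-zero N)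

sum-≤-∣∣* : ∀ {N} (P : Subset N) d {f : Fin N → ℕ} →
  (∀ i → f i ≤ [ P i ] * d) → sum f ≤ ∣ P ∣ * d
sum-≤-∣∣* P d f≤ = ≤-trans (sum-mono-≤ f≤) (≤-reflexive (sym (*-distribʳ-sum d (λ i → [ P i ]))))

∣full∣ : ∀ N → ∣ (λ (_ : Fin N) → true) ∣ ≡ N
∣full∣ zero    = refl
∣full∣ (suc N) = cong suc (∣full∣ N)

[]-split : ∀ s b c → [ s ∧ c ] ≡ [ (s ∧ b) ∧ c ] + [ (s ∧ not b) ∧ c ]
[]-split false b     c     = refl
[]-split true  true  true  = refl
[]-split true  true  false = refl
[]-split true  false c     = refl

∣∣-split : ∀ {N} (S p : Subset N) → ∣ S ∣ ≡ ∣ S ∩ p ∣ + ∣ S ∖ p ∣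
∣∣-split S p = trans (sum-cong-≗ split) (∑-distrib-+ (λ x → [ (S ∩ p) x ]) (λ x → [ (S ∖ p) x ]))
  where
    split : ∀ x → [ S x ] ≡ [ (S ∩ p) x ] + [ (S ∖ p) x ]
    split x with S x | p x
    ... | false | _     = refl
    ... | true  | true  = refl
    ... | true  | false = refl

∣∣-remove : ∀ {N} (Q : Subset N) k → ∣ Q ∣ ≡ [ Q k ] + ∣ Q ─ k ∣
∣∣-remove Q zero    = refl
∣∣-remove Q (suc k) = begin
  [ Q zero ] + ∣ Q ∘ suc ∣                            ≡⟨ cong ([ Q zero ] +_) (∣∣-remove (Q ∘ suc) k) ⟩
  [ Q zero ] + ([ Q (suc k) ] + ∣ (Q ∘ suc) ─ k ∣)   ≡⟨ +-Comm.x∙yz≈y∙xz [ Q zero ] [ Q (suc k) ] ∣ (Q ∘ suc) ─ k ∣ ⟩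
  [ Q (suc k) ] + ([ Q zero ] + ∣ (Q ∘ suc) ─ k ∣)   ∎
  where open ≡-Reasoning

does-sound : ∀ {p} {P : Set p} (d : Dec P) → does d ≡ true → P
does-sound (yes p) _ = p

∧-true : ∀ {a b} → a ∧ b ≡ true → a ≡ true × b ≡ true
∧-true {true} b≡true = refl , b≡true

∣∣-mono-inj : ∀ {N M} (P : Subset N) (Q : Subset M) (g : Fin N → Fin M) →
  (∀ x → P x ≡ true → Q (g x) ≡ true) →
  (∀ x y → P x ≡ true → P y ≡ true → g x ≡ g y → x ≡ y) → ∣ P ∣ ≤ ∣ Q ∣
∣∣-mono-inj {zero}  P Q g into inj = z≤n
∣∣-mono-inj {suc N} P Q g into inj with P zero in P0
... | false = ∣∣-mono-inj (P ∘ suc) Q (g ∘ suc) (into ∘ suc) (λ x y Px Py → suc-injective ∘ inj (suc x) (suc y) Px Py)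
... | true = begin
  1 + ∣ P ∘ suc ∣                  ≤⟨ s≤s (∣∣-mono-inj (P ∘ suc) (Q ─ g zero) (g ∘ suc) into-rest inj-rest) ⟩
  1 + ∣ Q ─ g zero ∣               ≡⟨ cong (λ b → [ b ] + ∣ Q ─ g zero ∣) (sym (into zero P0)) ⟩
  [ Q (g zero) ] + ∣ Q ─ g zero ∣  ≡⟨ sym (∣∣-remove Q (g zero)) ⟩
  ∣ Q ∣                            ∎
  where
    open ≤-Reasoning
    inj-rest : ∀ x y → P (suc x) ≡ true → P (suc y) ≡ true → g (suc x) ≡ g (suc y) → x ≡ y
    inj-rest x y Px Py = suc-injective ∘ inj (suc x) (suc y) Px Py
    -- g zero is the image of zero, so the rest of P maps into Q without it.
    into-rest : ∀ x → P (suc x) ≡ true → (Q ─ g zero) (g (suc x)) ≡ true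
    into-rest x Px = cong₂ (λ b q → not b ∧ q) (dec-false (g (suc x) ≟ g zero) fresh) (into (suc x) Px)
      where
        fresh : g (suc x) ≢ g zero
        fresh eq with inj (suc x) zero Px P0 eq
        ... | ()

∣∣-pos : ∀ {N} (P : Subset N) x → P x ≡ true → 1 ≤ ∣ P ∣
∣∣-pos P x Px = ∣∣-mono-inj (λ (_ : Fin 1) → true) P (λ _ → x) (λ _ _ → Px) λ { zero zero _ _ _ → refl }

∣∣≤1 : ∀ {N} (P : Subset N) → AtMostOne P → ∣ P ∣ ≤ 1
∣∣≤1 P one = ∣∣-mono-inj P (λ (_ : Fin 1) → true) (λ _ → zero) (λ _ _ → refl) (λ x y Px Py _ → one x y Px Py)

at-most-one-or-two : ∀ {N} (P : Subset N) → AtMostOne P ⊎ HasTwo P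
at-most-one-or-two P with any? (λ x → any? (λ y → (P x ≟ᵇ true) ×-dec (P y ≟ᵇ true) ×-dec ¬? (x ≟ y)))
... | yes two  = inj₂ two
... | no ¬two = inj₁ λ x y Px Py → decidable-stable (x ≟ y) (λ x≢y → ¬two (x , y , Px , Py , x≢y))

^-distribʳ-* : ∀ a b t → (a * b) ^ t ≡ a ^ t * b ^ t
^-distribʳ-* a b zero    = refl
^-distribʳ-* a b (suc t) = trans (cong (a * b *_) (^-distribʳ-* a b t)) (*-Comm.interchange a b (a ^ t) (b ^ t))

-- f(s) = s ^ (t s) is positive, also for s = 0.
1≤s^[t*s] : ∀ s t → 1 ≤ s ^ (t * s)
1≤s^[t*s] zero    t = ≤-reflexive (sym (cong (0 ^_) (*-zeroʳ t)))
1≤s^[t*s] (suc s) t = m^n>0 (suc s) (t * suc s)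

-- For a ≤ r: the smaller part's factor 2 ^ (t a) is absorbed by (2a) ^ (t a) ≤ (a + r) ^ (t a).
power-growth-≤ : ∀ t a r → a ≤ r → a ^ (t * a) * r ^ (t * r) * 2 ^ (t * a) ≤ (a + r) ^ (t * (a + r))
power-growth-≤ t a r a≤r = begin
  a ^ (t * a) * r ^ (t * r) * 2 ^ (t * a)      ≡⟨ *-Comm.xy∙z≈xz∙y (a ^ (t * a)) _ _ ⟩
  a ^ (t * a) * 2 ^ (t * a) * r ^ (t * r)      ≡⟨ cong (_* r ^ (t * r)) (sym (^-distribʳ-* a 2 (t * a))) ⟩
  (a * 2) ^ (t * a) * r ^ (t * r)              ≤⟨ *-mono-≤ (^-monoˡ-≤ (t * a) 2a≤a+r) (^-monoˡ-≤ (t * r) (m≤n+m r a)) ⟩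
  (a + r) ^ (t * a) * (a + r) ^ (t * r)        ≡⟨ sym (^-distribˡ-+-* (a + r) (t * a) (t * r)) ⟩
  (a + r) ^ (t * a + t * r)                    ≡⟨ cong ((a + r) ^_) (sym (*-distribˡ-+ t a r)) ⟩
  (a + r) ^ (t * (a + r))                      ∎
  where
    open ≤-Reasoning
    2a≤a+r : a * 2 ≤ a + r
    2a≤a+r = ≤-trans (≤-reflexive (trans (*-comm a 2) (cong (a +_) (+-identityʳ a)))) (+-monoʳ-≤ a a≤r)

power-growth : ∀ t a r → a ^ (t * a) * r ^ (t * r) * 2 ^ (t * (a ⊓ r)) ≤ (a + r) ^ (t * (a + r))
power-growth t a r with ≤-total a r
... | inj₁ a≤r rewrite m≤n⇒m⊓n≡m a≤r = power-growth-≤ t a r a≤r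
... | inj₂ r≤a rewrite m≥n⇒m⊓n≡n r≤a | *-comm (a ^ (t * a)) (r ^ (t * r)) | +-comm a r =
  power-growth-≤ t r a r≤a

part-≤ : ∀ {a r k} → 1 ≤ r → a + r ≤ suc k → a ≤ k
part-≤ {a} 1≤r a+r≤1+k = ≤-pred (≤-trans (≤-trans (≤-reflexive (+-comm 1 a)) (+-monoʳ-≤ a 1≤r)) a+r≤1+k)

-- x ≤ δ a and x ≤ r give x ≤ δ · min(a, r) (for δ = 0 the first forces x = 0).
≤-δ*min : ∀ δ a r x → x ≤ a * δ → x ≤ r → x ≤ δ * (a ⊓ r)
≤-δ*min δ a r x x≤aδ x≤r = ≤-trans (⊓-glb (≤-trans x≤aδ (≤-reflexive (*-comm a δ))) (x≤δr δ x≤aδ))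
                                     (≤-reflexive (sym (*-distribˡ-⊓ δ a r)))
  where
    x≤δr : ∀ d → x ≤ a * d → x ≤ d * r
    x≤δr zero    x≤a0 = ≤-trans x≤a0 (≤-reflexive (*-zeroʳ a))
    x≤δr (suc d) _    = ≤-trans x≤r (m≤m+n r (d * r))

-- The inductive step: two bounded parts plus at most 2 min(δ a, r) crossing edges.
merge-bound : ∀ δ a r e₁ e₂ x → 2 ^ e₁ ≤ a ^ (2 * δ * a) → 2 ^ e₂ ≤ r ^ (2 * δ * r) →
  x ≤ a * δ → x ≤ r → 2 ^ (e₁ + e₂ + (x + x)) ≤ (a + r) ^ (2 * δ * (a + r))
merge-bound δ a r e₁ e₂ x bound-a bound-r x≤aδ x≤r = begin
  2 ^ (e₁ + e₂ + (x + x))                              ≡⟨ ^-distribˡ-+-* 2 (e₁ + e₂) (x + x) ⟩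
  2 ^ (e₁ + e₂) * 2 ^ (x + x)                          ≡⟨ cong (_* 2 ^ (x + x)) (^-distribˡ-+-* 2 e₁ e₂) ⟩
  2 ^ e₁ * 2 ^ e₂ * 2 ^ (x + x)                        ≤⟨ *-mono-≤ (*-mono-≤ bound-a bound-r) (^-monoʳ-≤ 2 2x≤) ⟩
  a ^ (t * a) * r ^ (t * r) * 2 ^ (t * (a ⊓ r))        ≤⟨ power-growth t a r ⟩
  (a + r) ^ (t * (a + r))                              ∎
  where
    open ≤-Reasoning
    t = 2 * δ
    x≤ = ≤-δ*min δ a r x x≤aδ x≤r
    2x≤ : x + x ≤ t * (a ⊓ r)
    2x≤ = ≤-trans (+-mono-≤ x≤ (≤-trans x≤ (≤-reflexive (sym (+-identityʳ _)))))
                  (≤-reflexive (sym (*-assoc 2 δ (a ⊓ r))))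

module EdgeCounts (H : Graph) where

  Vertex : Set
  Vertex = Fin (n H)

  VSet : Set
  VSet = Subset (n H)

  pairs : (Vertex → Vertex → Bool) → VSet → VSet → ℕ
  pairs w P Q = ∑[ x < n H ] ∑[ y < n H ] [ P x ∧ Q y ∧ w x y ]

  ordered-edge : Vertex → Vertex → Bool
  ordered-edge x y = (toℕ x <ᵇ toℕ y) ∧ adj H x y

  inner : VSet → ℕ
  inner S = pairs ordered-edge S S

  cross : VSet → VSet → ℕ
  cross = pairs (adj H)

  ∣E∣≡inner : ∣E∣ H ≡ inner (λ _ → true)
  ∣E∣≡inner = trans (sumF≡sum (λ x → countᵇ (ordered-edge x))) (sum-cong-≗ (λ x → countᵇ≡∣∣ (ordered-edge x)))

  ∑∑-distrib-+ : (f g : Vertex → Vertex → ℕ) →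
    ∑[ x < n H ] ∑[ y < n H ] (f x y + g x y) ≡ ∑[ x < n H ] ∑[ y < n H ] f x y + ∑[ x < n H ] ∑[ y < n H ] g x y
  ∑∑-distrib-+ f g = trans (sum-cong-≗ (λ x → ∑-distrib-+ (f x) (g x)))
                            (∑-distrib-+ (λ x → ∑[ y < n H ] f x y) (λ x → ∑[ y < n H ] g x y))

  pairs-splitˡ : ∀ w P Q p → pairs w P Q ≡ pairs w (P ∩ p) Q + pairs w (P ∖ p) Q
  pairs-splitˡ w P Q p =
    trans (sum-cong-≗ (λ x → sum-cong-≗ (λ y → []-split (P x) (p x) (Q y ∧ w x y))))
          (∑∑-distrib-+ (λ x y → [ (P ∩ p) x ∧ Q y ∧ w x y ]) (λ x y → [ (P ∖ p) x ∧ Q y ∧ w x y ]))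

  pairs-splitʳ : ∀ w P Q q → pairs w P Q ≡ pairs w P (Q ∩ q) + pairs w P (Q ∖ q)
  pairs-splitʳ w P Q q =
    trans (sum-cong-≗ (λ x → sum-cong-≗ (λ y → split (P x) (Q y) (q y) (w x y))))
          (∑∑-distrib-+ (λ x y → [ P x ∧ (Q ∩ q) y ∧ w x y ]) (λ x y → [ P x ∧ (Q ∖ q) y ∧ w x y ]))
    where
      split : ∀ a s b c → [ a ∧ s ∧ c ] ≡ [ a ∧ (s ∧ b) ∧ c ] + [ a ∧ (s ∧ not b) ∧ c ]
      split false s b c = refl
      split true  s b c = []-split s b c

  pairs-restrict : ∀ (l w : Vertex → Vertex → Bool) P Q → pairs (λ x y → l x y ∧ w x y) P Q ≤ pairs w P Q
  pairs-restrict l w P Q = sum-mono-≤ (λ x → sum-mono-≤ (λ y → drop (P x) (Q y) (l x y) (w x y)))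
    where
      drop : ∀ a b c e → [ a ∧ b ∧ c ∧ e ] ≤ [ a ∧ b ∧ e ]
      drop false b     c     e = z≤n
      drop true  false c     e = z≤n
      drop true  true  false e = z≤n
      drop true  true  true  e = ≤-refl

  cross-sym : ∀ P Q → cross P Q ≡ cross Q P
  cross-sym P Q = trans (∑-comm (λ x y → [ P x ∧ Q y ∧ adj H x y ])) (sum-cong-≗ λ y → sum-cong-≗ λ x → swap (P x) (Q y) (adj-sym H x y))
    where
      swap : ∀ a b {e e′} → e ≡ e′ → [ a ∧ b ∧ e ] ≡ [ b ∧ a ∧ e′ ]
      swap true  true  e≡e′ = cong [_] e≡e′
      swap true  false _    = refl
      swap false true  _    = refl
      swap false false _    = refl

  inner-split : ∀ S p → inner S ≤ inner (S ∩ p) + inner (S ∖ p) + (cross (S ∩ p) (S ∖ p) + cross (S ∖ p) (S ∩ p))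
  inner-split S p = begin
    inner S                                             ≡⟨ pairs-splitˡ e S S p ⟩
    pairs e A S + pairs e R S                           ≡⟨ cong₂ _+_ (pairs-splitʳ e A S p) (pairs-splitʳ e R S p) ⟩
    (inner A + pairs e A R) + (pairs e R A + inner R)   ≡⟨ rearrange (inner A) (pairs e A R) (pairs e R A) (inner R) ⟩
    inner A + inner R + (pairs e A R + pairs e R A)     ≤⟨ +-monoʳ-≤ (inner A + inner R) (+-mono-≤
                                                             (pairs-restrict lt (adj H) A R) (pairs-restrict lt (adj H) R A)) ⟩
    inner A + inner R + (cross A R + cross R A)         ∎
    where
      open ≤-Reasoning
      open +-*-Solver
      e = ordered-edge
      lt = λ (x y : Vertex) → toℕ x <ᵇ toℕ y
      A = S ∩ p
      R = S ∖ p
      rearrange : ∀ a b c d → (a + b) + (c + d) ≡ a + d + (b + c)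
      rearrange = solve 4 (λ a b c d → (a :+ b) :+ (c :+ d) := a :+ d :+ (b :+ c)) refl

  cross-row-bound : ∀ P Q d → (∀ x → P x ≡ true → ∣ (λ y → Q y ∧ adj H x y) ∣ ≤ d) → cross P Q ≤ ∣ P ∣ * d
  cross-row-bound P Q d rows = sum-≤-∣∣* P d (λ x → row (P x) (rows x))
    where
      row : ∀ b {f : VSet} → (b ≡ true → ∣ f ∣ ≤ d) → ∑[ y < n H ] [ b ∧ f y ] ≤ [ b ] * d
      row true  bound = ≤-trans (bound refl) (≤-reflexive (sym (+-identityʳ d)))
      row false _     = ≤-reflexive (sum-replicate-zero (n H))

  -- A set with at most one vertex contains no edge (adjacency is irreflexive).
  inner-trivial : ∀ S → AtMostOne S → inner S ≡ 0
  inner-trivial S one = sum-zero (λ x → sum-zero (λ y → no-edge x y))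
    where
      no-edge : ∀ x y → [ S x ∧ S y ∧ ordered-edge x y ] ≡ 0
      no-edge x y with S x in Sx | S y in Sy
      ... | false | _     = refl
      ... | true  | false = refl
      ... | true  | true rewrite one x y Sx Sy | irrefl H y | ∧-zeroʳ (toℕ y <ᵇ toℕ y) = refl

  record Separation (δ : ℕ) (S : VSet) : Set where
    field
      side          : VSet
      inside        : Σ Vertex λ x → (S ∩ side) x ≡ true
      outside       : Σ Vertex λ y → (S ∖ side) y ≡ true
      cross-inside  : cross (S ∩ side) (S ∖ side) ≤ ∣ S ∩ side ∣ * δ
      cross-outside : cross (S ∖ side) (S ∩ side) ≤ ∣ S ∖ side ∣

  edge-bound : ∀ δ → (∀ S → HasTwo S → Separation δ S) → ∀ S → 2 ^ inner S ≤ ∣ S ∣ ^ (2 * δ * ∣ S ∣)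
  edge-bound δ separate S = bounded ∣ S ∣ S ≤-refl
    where
      bounded : ∀ k S → ∣ S ∣ ≤ k → 2 ^ inner S ≤ ∣ S ∣ ^ (2 * δ * ∣ S ∣)
      bounded k S ∣S∣≤k with at-most-one-or-two S
      bounded k S ∣S∣≤k | inj₁ one rewrite inner-trivial S one = 1≤s^[t*s] ∣ S ∣ (2 * δ)
      bounded zero S ∣S∣≤0 | inj₂ (u , _ , Su , _) = contradiction (≤-trans (∣∣-pos S u Su) ∣S∣≤0) λ ()
      bounded (suc k) S ∣S∣≤1+k | inj₂ two = begin
        2 ^ inner S                                  ≤⟨ ^-monoʳ-≤ 2 edges-split ⟩
        2 ^ (inner A + inner R + (X + X))            ≤⟨ merge-bound δ ∣ A ∣ ∣ R ∣ (inner A) (inner R) X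
                                                          (bounded k A ∣A∣≤k) (bounded k R ∣R∣≤k) cross-inside X≤∣R∣ ⟩
        (∣ A ∣ + ∣ R ∣) ^ (2 * δ * (∣ A ∣ + ∣ R ∣))   ≡⟨ cong (λ s → s ^ (2 * δ * s)) (sym (∣∣-split S side)) ⟩
        ∣ S ∣ ^ (2 * δ * ∣ S ∣)                      ∎
        where
          open ≤-Reasoning
          open Separation (separate S two)
          A = S ∩ side
          R = S ∖ side
          X = cross A R
          edges-split : inner S ≤ inner A + inner R + (X + X)
          edges-split = ≤-trans (inner-split S side)
            (+-monoʳ-≤ (inner A + inner R) (+-monoʳ-≤ X (≤-reflexive (cross-sym R A))))
          X≤∣R∣ : X ≤ ∣ R ∣
          X≤∣R∣ = ≤-trans (≤-reflexive (cross-sym A R)) cross-outside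
          ∣A∣+∣R∣≤1+k : ∣ A ∣ + ∣ R ∣ ≤ suc k
          ∣A∣+∣R∣≤1+k = ≤-trans (≤-reflexive (sym (∣∣-split S side))) ∣S∣≤1+k
          ∣A∣≤k : ∣ A ∣ ≤ k
          ∣A∣≤k = part-≤ (∣∣-pos R _ (proj₂ outside)) ∣A∣+∣R∣≤1+k
          ∣R∣≤k : ∣ R ∣ ≤ k
          ∣R∣≤k = part-≤ (∣∣-pos A _ (proj₂ inside)) (≤-trans (≤-reflexive (+-comm ∣ R ∣ ∣ A ∣)) ∣A∣+∣R∣≤1+k)

product-step : ∀ {m} (Gs : Fin m → Graph) j (p q : ProdVertex Gs) → ProdAdj Gs p q → p j ≢ q j →
  (∀ i → i ≢ j → p i ≡ q i) × Adj (Gs j) (p j) (q j)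
product-step Gs j p q (j′ , adjacent , same) p≢q with j′ ≟ j
... | yes refl = same , adjacent
... | no j′≢j  = contradiction (same j (j′≢j ∘ sym)) p≢q

module ProductSeparation {δ m} {Gs : Fin m → Graph} (degenerate : ∀ i → DegeneracyAtMost δ (Gs i))
  (H : Graph) (φ : Fin (n H) → ProdVertex Gs)
  (φ-injective : ∀ a b → _≈ᵥ_ {Gs = Gs} (φ a) (φ b) → a ≡ b)
  (φ-adjacent : ∀ a b → Adj H a b → ProdAdj Gs (φ a) (φ b)) where

  open EdgeCounts H

  rank : ∀ j → Fin (n (Gs j)) → Fin (n (Gs j))
  rank j c = proj₁ (degenerate j) ⟨$⟩ˡ c

  rank-injective : ∀ j {a b} → rank j a ≡ rank j b → a ≡ b
  rank-injective j {a} {b} eq = trans (sym (inverseʳ σ)) (trans (cong (σ ⟨$⟩ʳ_) eq) (inverseʳ σ))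
    where σ = proj₁ (degenerate j)

  leave-along-j : ∀ j w z z′ → Adj H w z → Adj H w z′ → φ w j ≢ φ z j → φ w j ≢ φ z′ j →
    φ z j ≡ φ z′ j → z ≡ z′
  leave-along-j j w z z′ w~z w~z′ w≢z w≢z′ z≡z′ = φ-injective z z′ agree
    where
      agree : ∀ i → φ z i ≡ φ z′ i
      agree i with i ≟ j
      ... | yes refl = z≡z′
      ... | no i≢j   = trans (sym (proj₁ (product-step Gs j _ _ (φ-adjacent w z w~z) w≢z) i i≢j))
                             (proj₁ (product-step Gs j _ _ (φ-adjacent w z′ w~z′) w≢z′) i i≢j)

  module CoordinateSplit (S : VSet) (j : Fin m) (c : Fin (n (Gs j)))
    (c-first : ∀ y → S y ≡ true → toℕ (rank j c) ≤ toℕ (rank j (φ y j))) where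

    at-c : VSet
    at-c w = does (φ w j ≟ c)

    A R : VSet
    A = S ∩ at-c
    R = S ∖ at-c

    in-A : ∀ x → S x ≡ true → φ x j ≡ c → A x ≡ true
    in-A x Sx eq = cong₂ _∧_ Sx (dec-true (φ x j ≟ c) eq)

    in-R : ∀ y → S y ≡ true → φ y j ≢ c → R y ≡ true
    in-R y Sy ne = cong₂ (λ s b → s ∧ not b) Sy (dec-false (φ y j ≟ c) ne)

    A-at-c : ∀ x → A x ≡ true → φ x j ≡ c
    A-at-c x Ax = does-sound (φ x j ≟ c) (proj₂ (∧-true Ax))

    R-off-c : ∀ y → R y ≡ true → φ y j ≢ c
    R-off-c y Ry eq = contradiction (trans (sym (cong not (dec-true (φ y j ≟ c) eq))) (proj₂ (∧-true Ry))) λ ()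

    -- A vertex outside has at most one neighbour inside: its j-th coordinate reset to c.
    cross-outside : cross R A ≤ ∣ R ∣
    cross-outside = ≤-trans (cross-row-bound R A 1 λ y Ry → ∣∣≤1 _ (one y Ry)) (≤-reflexive (*-identityʳ ∣ R ∣))
      where
        one : ∀ y → R y ≡ true → AtMostOne (λ x → A x ∧ adj H y x)
        one y Ry x x′ Ax∧y~x Ax′∧y~x′ =
          leave-along-j j y x x′ y~x y~x′ (leaves Ax) (leaves Ax′) (trans (A-at-c x Ax) (sym (A-at-c x′ Ax′)))
          where
            Ax = proj₁ (∧-true Ax∧y~x)
            y~x = proj₂ (∧-true Ax∧y~x)
            Ax′ = proj₁ (∧-true Ax′∧y~x′)
            y~x′ = proj₂ (∧-true Ax′∧y~x′)
            leaves : ∀ {z} → A z ≡ true → φ y j ≢ φ z j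
            leaves {z} Az eq = R-off-c y Ry (trans eq (A-at-c z Az))

    -- A vertex inside has at most δ neighbours outside: their j-th coordinates are
    -- distinct neighbours of c that come later in the degeneracy order.
    cross-inside : cross A R ≤ ∣ A ∣ * δ
    cross-inside = cross-row-bound A R δ λ x Ax →
      ≤-trans (∣∣-mono-inj _ later (λ y → rank j (φ y j)) (into x Ax) (inj x Ax))
              (≤-trans (≤-reflexive (sym (countᵇ≡∣∣ later))) (proj₂ (degenerate j) (rank j c)))
      where
        σ = proj₁ (degenerate j)
        later : Subset (n (Gs j))
        later k = (toℕ (rank j c) <ᵇ toℕ k) ∧ adj (Gs j) (σ ⟨$⟩ʳ rank j c) (σ ⟨$⟩ʳ k)
        leaves : ∀ x y → A x ≡ true → R y ≡ true → φ x j ≢ φ y j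
        leaves x y Ax Ry eq = R-off-c y Ry (trans (sym eq) (A-at-c x Ax))
        into : ∀ x → A x ≡ true → ∀ y → (R y ∧ adj H x y) ≡ true → later (rank j (φ y j)) ≡ true
        into x Ax y Ry∧x~y = cong₂ _∧_ (Equivalence.to T-≡ (<⇒<ᵇ c-before-y)) c~y-by-rank
          where
            Ry = proj₁ (∧-true Ry∧x~y)
            c-before-y : toℕ (rank j c) < toℕ (rank j (φ y j))
            c-before-y = ≤∧≢⇒< (c-first y (proj₁ (∧-true Ry)))
                               (λ eq → R-off-c y Ry (sym (rank-injective j (toℕ-injective eq))))
            c~y : Adj (Gs j) c (φ y j)
            c~y = subst (λ a → Adj (Gs j) a (φ y j)) (A-at-c x Ax)
                        (proj₂ (product-step Gs j (φ x) (φ y) (φ-adjacent x y (proj₂ (∧-true Ry∧x~y))) (leaves x y Ax Ry)))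
            c~y-by-rank : Adj (Gs j) (σ ⟨$⟩ʳ rank j c) (σ ⟨$⟩ʳ rank j (φ y j))
            c~y-by-rank = subst₂ (Adj (Gs j)) (sym (inverseʳ σ)) (sym (inverseʳ σ)) c~y
        inj : ∀ x → A x ≡ true → ∀ y y′ → (R y ∧ adj H x y) ≡ true → (R y′ ∧ adj H x y′) ≡ true →
          rank j (φ y j) ≡ rank j (φ y′ j) → y ≡ y′
        inj x Ax y y′ Ry∧x~y Ry′∧x~y′ eq =
          leave-along-j j x y y′ (proj₂ (∧-true Ry∧x~y)) (proj₂ (∧-true Ry′∧x~y′))
            (leaves x y Ax (proj₁ (∧-true Ry∧x~y))) (leaves x y′ Ax (proj₁ (∧-true Ry′∧x~y′))) (rank-injective j eq)

  separation : ∀ S → HasTwo S → Separation δ S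
  separation S (u , v , Su , Sv , u≢v) = record
    { side          = at-c
    ; inside        = x₀ , in-A x₀ Sx₀ refl
    ; outside       = outside
    ; cross-inside  = cross-inside
    ; cross-outside = cross-outside
    }
    where
      differ : ∃ λ j → φ u j ≢ φ v j
      differ = ¬∀⟶∃¬ m (λ i → φ u i ≡ φ v i) (λ i → φ u i ≟ φ v i) (u≢v ∘ φ-injective u v)
      j = proj₁ differ
      key : Vertex → ℕ
      key w = toℕ (rank j (φ w j))
      members = filter (λ w → S w ≟ᵇ true) (allFin (n H))
      x₀ = argmin key u members
      Sx₀ : S x₀ ≡ true
      Sx₀ = argmin-all key Su (all-filter (λ w → S w ≟ᵇ true) (allFin (n H)))
      x₀-first : ∀ y → S y ≡ true → key x₀ ≤ key y
      x₀-first y Sy = lookup (f[argmin]≤f[xs] {f = key} u members) (∈-filter⁺ (λ w → S w ≟ᵇ true) (∈-allFin y) Sy)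
      open CoordinateSplit S j (φ x₀ j) x₀-first
      outside : Σ Vertex λ y → R y ≡ true
      outside with φ u j ≟ φ x₀ j
      ... | no  u≢c = u , in-R u Su u≢c
      ... | yes u≡c = v , in-R v Sv (λ v≡c → proj₂ differ (trans u≡c (sym v≡c)))

corollary7p1 : (δ m : ℕ) (Gs : Fin m → Graph) →
    (∀ i → Connected (Gs i)) → (∀ i → DegeneracyAtMost δ (Gs i)) →
    (H : Graph) → SubgraphOfProduct H Gs → ∣V∣ H ≥ 1 →
    2 ^ ∣E∣ H ≤ ∣V∣ H ^ (2 * δ * ∣V∣ H)
corollary7p1 δ m Gs _ degenerate H (φ , φ-injective , φ-adjacent) _ =
  subst₂ (λ e s → 2 ^ e ≤ s ^ (2 * δ * s)) (sym ∣E∣≡inner) (∣full∣ (n H))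
    (edge-bound δ separation (λ _ → true))
  where
    open EdgeCounts H
    open ProductSeparation {Gs = Gs} degenerate H φ φ-injective φ-adjacent
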